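{- There is an absolute constant $c_0$ such that for every graph $G$ on $n\ge 2$ vertices (without complete stars), $\mathrm{cc}(G)\le D(G)+2\log_2 n + c_0$.
   Context: Let $G=(V,F)$ be a graph with $|V|=n$. Standing assumption: $G$ has no complete star, i.e. no vertex adjacent to all other vertices. A nonedge is a pair of distinct nonadjacent vertices. A clique is a set of pairwise adjacent vertices; $\omega(G)$ denotes the maximum size of a clique in $G$. Clique game on $G$ (with $G$ fixed and known to both players): Alice gets $a\subseteq V$, Bob gets $b\subseteq V$ with $a\cap b=\emptyset$ and $|a|+|b|>\omega(G)$; the goal is for both players to find (and both know at the end) a nonedge of $G$ with both endpoints in $a\cup b$. $\mathrm{cc}(G)$ is the minimum, over all deterministic communication protocols solving this game, of the number of bits communicated on a worst-case input. For $1\le k\le n$, the induced $k$-clique function of $G$ is the monotone Boolean function of $n$ variables (one per vertex) that, on input a set $S\subseteq V$ of vertices, outputs $1$ iff some $k$ vertices of $S$ form a clique in $G$. A monotone circuit consists of fanin-2 AND and OR gates with input variables (no negations); its depth is the length of a longest input-to-output path. $D(G)$ is the maximum over $1\le k\le n$ of the minimum depth of a monotone circuit computing the induced $k$-clique function of $G$. -}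

module Defs where

open import Data.Nat using (ℕ; zero; suc; _+_; _≤_; _<_; _⊔_)
open import Data.Fin using (Fin; inject₁)
open import Data.Fin.Subset using (Subset; _∈_; _∉_; _⊆_; _∪_; ∣_∣)
open import Data.Bool using (Bool; true; false; _∧_; _∨_)
open import Data.Vec using (Vec; []; _∷ʳ_; lookup)
open import Data.Product using (Σ; _×_; _,_; ∃)
open import Relation.Nullary using (¬_; Dec)
open import Relation.Binary.PropositionalEquality using (_≡_; _≢_)
open import Function.Bundles using (_⇔_)

record Graph (n : ℕ) : Set₁ where
  field
    E     : Fin n → Fin n → Set
    dec   : ∀ u v → Dec (E u v)
    sym   : ∀ {u v} → E u v → E v u
    irrefl : ∀ {u} → ¬ E u u
open Graph public

module _ {n : ℕ} (G : Graph n) where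

  NoCompleteStar : Set
  NoCompleteStar = ∀ v → ∃ λ u → u ≢ v × ¬ E G v u

  Nonedge : Fin n → Fin n → Set
  Nonedge u v = u ≢ v × ¬ E G u v

  IsClique : Subset n → Set
  IsClique T = ∀ u v → u ∈ T → v ∈ T → u ≢ v → E G u v

  IsCliqueNumber : ℕ → Set
  IsCliqueNumber w = (∃ λ T → IsClique T × ∣ T ∣ ≡ w)
                   × (∀ T → IsClique T → ∣ T ∣ ≤ w)

data Protocol (X Y O : Set) : Set where
  leaf  : O → Protocol X Y O
  alice : (X → Bool) → (on0 on1 : Protocol X Y O) → Protocol X Y O
  bob   : (Y → Bool) → (on0 on1 : Protocol X Y O) → Protocol X Y O

module _ {X Y O : Set} where

  run : Protocol X Y O → X → Y → O
  run (leaf o)      x y = o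
  run (alice f p q) x y with f x
  ... | false = run p x y
  ... | true  = run q x y
  run (bob g p q)   x y with g y
  ... | false = run p x y
  ... | true  = run q x y

  bits : Protocol X Y O → X → Y → ℕ
  bits (leaf o)      x y = 0
  bits (alice f p q) x y with f x
  ... | false = suc (bits p x y)
  ... | true  = suc (bits q x y)
  bits (bob g p q)   x y with g y
  ... | false = suc (bits p x y)
  ... | true  = suc (bits q x y)

module _ {n : ℕ} (G : Graph n) (w : ℕ) where

  ValidInput : Subset n → Subset n → Set
  ValidInput a b = (∀ v → v ∈ a → v ∉ b) × w < ∣ a ∣ + ∣ b ∣

  SolvesWithin : Protocol (Subset n) (Subset n) (Fin n × Fin n) → ℕ → Set
  SolvesWithin P c = ∀ a b → ValidInput a b →
    bits P a b ≤ c ×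
    (let (u , v) = run P a b in u ∈ (a ∪ b) × v ∈ (a ∪ b) × Nonedge G u v)

  CCAtMost : ℕ → Set
  CCAtMost c = ∃ λ P → SolvesWithin P c

  IsCC : ℕ → Set
  IsCC c = CCAtMost c × (∀ c' → CCAtMost c' → c ≤ c')

-- A wire of a circuit with k previously built gates is an input
-- variable, a constant, or one of those k gates.

data Wire (n k : ℕ) : Set where
  var   : Fin n → Wire n k
  const : Bool → Wire n k
  gate  : Fin k → Wire n k

data Gate (n k : ℕ) : Set where
  AND OR : Wire n k → Wire n k → Gate n k

data Gates (n : ℕ) : ℕ → Set where
  []  : Gates n 0
  _▷_ : ∀ {k} → Gates n k → Gate n k → Gates n (suc k)

record Circuit (n : ℕ) : Set where
  constructor circuit
  field
    size  : ℕ
    gates : Gates n size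
    out   : Wire n size
open Circuit public

module _ {n : ℕ} where

  evalWire : ∀ {k} → Subset n → Vec Bool k → Wire n k → Bool
  evalWire x vs (var i)   = lookup x i
  evalWire x vs (const b) = b
  evalWire x vs (gate j)  = lookup vs j

  evalGate : ∀ {k} → Subset n → Vec Bool k → Gate n k → Bool
  evalGate x vs (AND p q) = evalWire x vs p ∧ evalWire x vs q
  evalGate x vs (OR p q)  = evalWire x vs p ∨ evalWire x vs q

  evalGates : ∀ {k} → Subset n → Gates n k → Vec Bool k
  evalGates x []       = []
  evalGates x (gs ▷ g) = let vs = evalGates x gs in vs ∷ʳ evalGate x vs g

  eval : Circuit n → Subset n → Bool
  eval C x = evalWire x (evalGates x (gates C)) (out C)

  depthWire : ∀ {k} → Vec ℕ k → Wire n k → ℕ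
  depthWire ds (var i)   = 0
  depthWire ds (const b) = 0
  depthWire ds (gate j)  = lookup ds j

  depthGate : ∀ {k} → Vec ℕ k → Gate n k → ℕ
  depthGate ds (AND p q) = suc (depthWire ds p ⊔ depthWire ds q)
  depthGate ds (OR p q)  = suc (depthWire ds p ⊔ depthWire ds q)

  depthGates : ∀ {k} → Gates n k → Vec ℕ k
  depthGates []       = []
  depthGates (gs ▷ g) = let ds = depthGates gs in ds ∷ʳ depthGate ds g

  depth : Circuit n → ℕ
  depth C = depthWire (depthGates (gates C)) (out C)

module _ {n : ℕ} (G : Graph n) where

  HasKClique : ℕ → Subset n → Set
  HasKClique k S = ∃ λ T → T ⊆ S × IsClique G T × ∣ T ∣ ≡ k

  Computes : Circuit n → ℕ → Set
  Computes C k = ∀ S → (eval C S ≡ true) ⇔ HasKClique k S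

  IsMinDepth : ℕ → ℕ → Set
  IsMinDepth k δ = (∃ λ C → Computes C k × depth C ≡ δ)
                 × (∀ C → Computes C k → δ ≤ depth C)

  IsD : ℕ → Set
  IsD d = (∀ k δ → 1 ≤ k → k ≤ n → IsMinDepth k δ → δ ≤ d)
        × (∃ λ k → 1 ≤ k × k ≤ n × IsMinDepth k d)

-- Each player first says (one bit) whether their set is a clique and, if it is not, sends a
-- nonedge inside it.  Otherwise k = ∣a∣ ≥ 1, because ∣b∣ ≤ ω < ∣a∣ + ∣b∣.  Alice sends k, and the
-- players run the Karchmer–Wigderson game of a monotone circuit of depth ≤ D(G) for the induced
-- k-clique function on a, which it accepts, and on the common neighbourhood N(b) of b, which it
-- rejects: a k-clique inside N(b) together with b would be a clique of size k + ∣b∣ > ω.  The game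
-- yields i ∈ a ∖ N(b), so some j ∈ b is not adjacent to i, and Bob sends j.  Apart from the two
-- bits, every message is a number below n and takes ⌈log₂ n⌉ bits, so cc(G) ≤ D(G) + 2⌈log₂ n⌉ + 2.
-- Minimum-depth circuits exist only classically, which is harmless since the inequality to be
-- proved is decidable.

module Submission where

open import Defs
open import Data.Nat using (ℕ; zero; suc; >-nonZero; _+_; _*_; _^_; _∸_; _≤_; _<_; _≤?_; z≤n; s≤s)
import Data.Nat.Properties as ℕ
open import Data.Nat.Properties
  using ( ≤-refl; ≤-trans; ≤-reflexive; ≰⇒>; +-mono-≤; +-monoʳ-≤; +-identityʳ; m≤m⊔n; m≤n⊔m
        ; n<1⇒n≡0; ∸-monoˡ-<; m+n∸m≡n; m+[n∸m]≡n)
open import Data.Nat.DivMod using (_mod_; m<n⇒m%n≡m)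
open import Data.Nat.Induction using (<-rec)
open import Data.Nat.Tactic.RingSolver using (solve-∀)
open import Data.Bool using (Bool; true; false; if_then_else_; _∧_; _∨_)
open import Data.Bool.Properties using (∧-conicalˡ; ∧-conicalʳ; ∨-conicalˡ; ∨-conicalʳ; ∨-zeroʳ; ¬-not)
open import Data.Empty using (⊥-elim)
open import Data.Fin using (Fin; zero; suc; toℕ; fromℕ; fromℕ<; inject₁; _≟_)
open import Data.Fin.Properties using (toℕ<n; toℕ-injective; toℕ-fromℕ<; any?)
open import Data.Fin.Relation.Unary.Top using (view; ‵fromℕ; ‵inject₁)
open import Data.Fin.Subset using (Subset; _∈_; _∉_; _⊆_; _∪_; ∣_∣)
open import Data.Fin.Subset.Properties using (_∈?_; x∈p∪q⁺; x∈p∪q⁻; ∣p∣≤n)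
open import Data.Vec using (Vec; []; _∷_; _∷ʳ_; lookup; tabulate; here; there)
open import Data.Vec.Properties using ([]=⇒lookup; lookup⇒[]=; lookup∘tabulate)
open import Data.Product using (∃; _×_; _,_; proj₁; proj₂)
open import Data.Sum using (inj₁; inj₂)
open import Function using (id; _∘_)
open import Function.Bundles using (mk⇔; Equivalence)
open import Relation.Nullary using (¬_; Dec; yes; no; does; ¬?; _×-dec_; map′; decidable-stable; ¬¬-map)
open import Relation.Nullary.Decidable using (dec-true; dec-false)
open import Relation.Binary.PropositionalEquality as ≡ using (_≡_; refl; cong; cong₂; trans; subst)

does-true : ∀ {P : Set} (P? : Dec P) → does P? ≡ true → P
does-true (yes p) _ = p

does-false : ∀ {P : Set} (P? : Dec P) → does P? ≡ false → ¬ P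
does-false (no ¬p) _ = ¬p

witness : ∀ {A : Set} {P : A → Set} → A → Dec (∃ P) → A
witness _ (yes (x , _)) = x
witness a (no _)        = a

witness-holds : ∀ {A : Set} {P : A → Set} a (P? : Dec (∃ P)) → ∃ P → P (witness a P?)
witness-holds _ (yes (_ , px)) _  = px
witness-holds _ (no ∄)        ∃P = ⊥-elim (∄ ∃P)

∣p∪q∣≡∣p∣+∣q∣ : ∀ {n} (p q : Subset n) → (∀ {i} → i ∈ p → i ∉ q) → ∣ p ∪ q ∣ ≡ ∣ p ∣ + ∣ q ∣
∣p∪q∣≡∣p∣+∣q∣ []          []          _ = refl
∣p∪q∣≡∣p∣+∣q∣ (true ∷ p)  (true ∷ q)  disjoint = ⊥-elim (disjoint here here)
∣p∪q∣≡∣p∣+∣q∣ (true ∷ p)  (false ∷ q) disjoint =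
  cong suc (∣p∪q∣≡∣p∣+∣q∣ p q (λ i∈p i∈q → disjoint (there i∈p) (there i∈q)))
∣p∪q∣≡∣p∣+∣q∣ (false ∷ p) (true ∷ q)  disjoint =
  trans (cong suc (∣p∪q∣≡∣p∣+∣q∣ p q (λ i∈p i∈q → disjoint (there i∈p) (there i∈q)))) (≡.sym (ℕ.+-suc _ _))
∣p∪q∣≡∣p∣+∣q∣ (false ∷ p) (false ∷ q) disjoint =
  ∣p∪q∣≡∣p∣+∣q∣ p q (λ i∈p i∈q → disjoint (there i∈p) (there i∈q))

n≤o<m+n⇒0<m : ∀ {m n o} → n ≤ o → o < m + n → 0 < m
n≤o<m+n⇒0<m {zero}  n≤o o<n = ⊥-elim (ℕ.<⇒≱ o<n n≤o)
n≤o<m+n⇒0<m {suc m} _   _   = s≤s z≤n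

lookup-∷ʳ-fromℕ : ∀ {A : Set} {k} (xs : Vec A k) x → lookup (xs ∷ʳ x) (fromℕ k) ≡ x
lookup-∷ʳ-fromℕ []       x = refl
lookup-∷ʳ-fromℕ (_ ∷ xs) x = lookup-∷ʳ-fromℕ xs x

lookup-∷ʳ-inject₁ : ∀ {A : Set} {k} (xs : Vec A k) x j → lookup (xs ∷ʳ x) (inject₁ j) ≡ lookup xs j
lookup-∷ʳ-inject₁ (_ ∷ xs) x zero    = refl
lookup-∷ʳ-inject₁ (_ ∷ xs) x (suc j) = lookup-∷ʳ-inject₁ xs x j

toℕ-mod : ∀ {m} (i : Fin (suc m)) → toℕ i mod suc m ≡ i
toℕ-mod i = toℕ-injective (trans (toℕ-fromℕ< _) (m<n⇒m%n≡m (toℕ<n i)))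

¬¬-least : ∀ (P : ℕ → Set) {m} → P m → ¬ ¬ ∃ λ δ → P δ × (∀ m → P m → δ ≤ m)
¬¬-least P {m} pm no-least = <-rec (λ m → ¬ P m) below-least m pm
  where
    below-least : ∀ m → (∀ {k} → k < m → ¬ P k) → ¬ P m
    below-least m smaller pm = no-least (m , pm , λ k pk → ℕ.≮⇒≥ (λ k<m → smaller k<m pk))

¬¬-choice : ∀ {m} {A : Fin m → Set} → (∀ i → ¬ ¬ A i) → ¬ ¬ (∀ i → A i)
¬¬-choice {zero}  _     none = none λ ()
¬¬-choice {suc m} ¬¬A none =
  ¬¬A zero λ a₀ → ¬¬-choice (¬¬A ∘ suc) λ as → none λ { zero → a₀ ; (suc i) → as i }

data Party : Set where
  Alice Bob : Party

module _ {X Y : Set} where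

  Input : Party → Set
  Input Alice = X
  Input Bob   = Y

  input : (p : Party) → X → Y → Input p
  input Alice x y = x
  input Bob   x y = y

  ask : ∀ {O} (p : Party) → (Input p → Bool) → (on0 on1 : Protocol X Y O) → Protocol X Y O
  ask Alice = alice
  ask Bob   = bob

  record Within {O} (P : Protocol X Y O) (x : X) (y : Y) (c : ℕ) (Q : O → Set) : Set where
    constructor within
    field
      bits≤ : bits P x y ≤ c
      holds : Q (run P x y)

  module _ {O : Set} {x : X} {y : Y} where

    within-mono : ∀ {P : Protocol X Y O} {c c′ Q R} →
                  c ≤ c′ → (∀ {o} → Q o → R o) → Within P x y c Q → Within P x y c′ R
    within-mono c≤c′ Q⇒R (within bits≤c q) = within (≤-trans bits≤c c≤c′) (Q⇒R q)

    leaf-within : ∀ {o} {Q : O → Set} → Q o → Within (leaf o) x y 0 Q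
    leaf-within q = within z≤n q

    run-ask : ∀ p f (P₀ P₁ : Protocol X Y O) →
              run (ask p f P₀ P₁) x y ≡ run (if f (input p x y) then P₁ else P₀) x y
    run-ask Alice f P₀ P₁ with f x
    ... | false = refl
    ... | true  = refl
    run-ask Bob f P₀ P₁ with f y
    ... | false = refl
    ... | true  = refl

    bits-ask : ∀ p f (P₀ P₁ : Protocol X Y O) →
               bits (ask p f P₀ P₁) x y ≡ suc (bits (if f (input p x y) then P₁ else P₀) x y)
    bits-ask Alice f P₀ P₁ with f x
    ... | false = refl
    ... | true  = refl
    bits-ask Bob f P₀ P₁ with f y
    ... | false = refl
    ... | true  = refl

    ask-within : ∀ p f {P₀ P₁ : Protocol X Y O} {c Q} b → f (input p x y) ≡ b →
                 Within (if b then P₁ else P₀) x y c Q → Within (ask p f P₀ P₁) x y (suc c) Q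
    ask-within p f {P₀} {P₁} {Q = Q} _ refl (within bits≤c q) =
      within (subst (_≤ _) (≡.sym (bits-ask p f P₀ P₁)) (s≤s bits≤c))
             (subst Q (≡.sym (run-ask p f P₀ P₁)) q)

  _>>=_ : ∀ {A B} → Protocol X Y A → (A → Protocol X Y B) → Protocol X Y B
  leaf o      >>= k = k o
  alice f p q >>= k = alice f (p >>= k) (q >>= k)
  bob g p q   >>= k = bob g (p >>= k) (q >>= k)

  map : ∀ {A B} → (A → B) → Protocol X Y A → Protocol X Y B
  map f P = P >>= λ o → leaf (f o)

  module _ {A B : Set} (x : X) (y : Y) (k : A → Protocol X Y B) where

    run->>= : ∀ P → run (P >>= k) x y ≡ run (k (run P x y)) x y
    run->>= (leaf o) = refl
    run->>= (alice f p q) with f x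
    ... | false = run->>= p
    ... | true  = run->>= q
    run->>= (bob g p q) with g y
    ... | false = run->>= p
    ... | true  = run->>= q

    bits->>= : ∀ P → bits (P >>= k) x y ≡ bits P x y + bits (k (run P x y)) x y
    bits->>= (leaf o) = refl
    bits->>= (alice f p q) with f x
    ... | false = cong suc (bits->>= p)
    ... | true  = cong suc (bits->>= q)
    bits->>= (bob g p q) with g y
    ... | false = cong suc (bits->>= p)
    ... | true  = cong suc (bits->>= q)

  module _ {A B : Set} {x : X} {y : Y} where

    >>=-within : ∀ {P : Protocol X Y A} {k : A → Protocol X Y B} {c c′ Q R} →
                 Within P x y c Q → (∀ {o} → Q o → Within (k o) x y c′ R) →
                 Within (P >>= k) x y (c + c′) R
    >>=-within {P} {k} {c} {c′} {R = R} (within bits≤c q) continue =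
      let within bits≤c′ r = continue q in
      within (subst (_≤ c + c′) (≡.sym (bits->>= x y k P)) (+-mono-≤ bits≤c bits≤c′))
             (subst R (≡.sym (run->>= x y k P)) r)

    map-within : ∀ {f : A → B} {P c Q R} →
                 Within P x y c Q → (∀ {o} → Q o → R (f o)) → Within (map f P) x y c R
    map-within {c = c} w Q⇒Rf =
      within-mono (≤-reflexive (+-identityʳ c)) id (>>=-within w (λ q → leaf-within (Q⇒Rf q)))

module _ {X Y X′ Y′ O : Set} (f : X → X′) (g : Y → Y′) where

  relabel : Protocol X′ Y′ O → Protocol X Y O
  relabel (leaf o)      = leaf o
  relabel (alice h p q) = alice (h ∘ f) (relabel p) (relabel q)
  relabel (bob h p q)   = bob (h ∘ g) (relabel p) (relabel q)

  module _ (x : X) (y : Y) where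

    run-relabel : ∀ P → run (relabel P) x y ≡ run P (f x) (g y)
    run-relabel (leaf o) = refl
    run-relabel (alice h p q) with h (f x)
    ... | false = run-relabel p
    ... | true  = run-relabel q
    run-relabel (bob h p q) with h (g y)
    ... | false = run-relabel p
    ... | true  = run-relabel q

    bits-relabel : ∀ P → bits (relabel P) x y ≡ bits P (f x) (g y)
    bits-relabel (leaf o) = refl
    bits-relabel (alice h p q) with h (f x)
    ... | false = cong suc (bits-relabel p)
    ... | true  = cong suc (bits-relabel q)
    bits-relabel (bob h p q) with h (g y)
    ... | false = cong suc (bits-relabel p)
    ... | true  = cong suc (bits-relabel q)

    relabel-within : ∀ {P c Q} → Within P (f x) (g y) c Q → Within (relabel P) x y c Q
    relabel-within {P} {Q = Q} (within bits≤c q) =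
      within (subst (_≤ _) (≡.sym (bits-relabel P)) bits≤c) (subst Q (≡.sym (run-relabel P)) q)

module _ {X Y : Set} where

  sendℕ : (p : Party) → ℕ → (Input p → ℕ) → Protocol X Y ℕ
  sendℕ p zero    v = leaf 0
  sendℕ p (suc L) v =
    ask p (λ z → does (2 ^ L ≤? v z))
      (sendℕ p L v)
      (map (2 ^ L +_) (sendℕ p L (λ z → v z ∸ 2 ^ L)))

  sendℕ-within : ∀ p L v {x y} → v (input p x y) < 2 ^ L →
                 Within (sendℕ p L v) x y L (_≡ v (input p x y))
  sendℕ-within p zero v v<1 = leaf-within (≡.sym (n<1⇒n≡0 v<1))
  sendℕ-within p (suc L) v {x} {y} v<2^1+L with 2 ^ L ≤? v (input p x y) in eq
  ... | no  v≱2^L = ask-within p _ false (cong does eq) (sendℕ-within p L v (≰⇒> v≱2^L))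
  ... | yes v≥2^L = ask-within p _ true (cong does eq)
        (map-within (sendℕ-within p L (λ z → v z ∸ 2 ^ L) low<2^L)
                    (λ r≡ → trans (cong (2 ^ L +_) r≡) (m+[n∸m]≡n v≥2^L)))
    where
      low<2^L : v (input p x y) ∸ 2 ^ L < 2 ^ L
      low<2^L = subst (v (input p x y) ∸ 2 ^ L <_) (m+n∸m≡n (2 ^ L) (2 ^ L))
                  (∸-monoˡ-< (subst (v (input p x y) <_) (cong (2 ^ L +_) (+-identityʳ (2 ^ L))) v<2^1+L)
                             v≥2^L)

  sendFin : ∀ {m} (p : Party) → ℕ → (Input p → Fin (suc m)) → Protocol X Y (Fin (suc m))
  sendFin {m} p L v = map (_mod suc m) (sendℕ p L (toℕ ∘ v))

  sendFin-within : ∀ {m} p L (v : Input p → Fin (suc m)) {x y} → suc m ≤ 2 ^ L →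
                   Within (sendFin p L v) x y L (_≡ v (input p x y))
  sendFin-within p L v m<2^L =
    map-within (sendℕ-within p L (toℕ ∘ v) (≤-trans (toℕ<n _) m<2^L))
               (λ r≡ → trans (cong (_mod _) r≡) (toℕ-mod _))

  sendPair : ∀ {m} (p : Party) → ℕ → (Input p → Fin (suc m) × Fin (suc m)) →
             Protocol X Y (Fin (suc m) × Fin (suc m))
  sendPair p L v = do
    u ← sendFin p L (proj₁ ∘ v)
    map (u ,_) (sendFin p L (proj₂ ∘ v))

  sendPair-within : ∀ {m} p L (v : Input p → Fin (suc m) × Fin (suc m)) {x y} → suc m ≤ 2 ^ L →
                    Within (sendPair p L v) x y (L + L) (_≡ v (input p x y))
  sendPair-within p L v m<2^L =
    >>=-within (sendFin-within p L (proj₁ ∘ v) m<2^L) λ { refl →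
    map-within (sendFin-within p L (proj₂ ∘ v) m<2^L) λ { refl → refl } }

-- Karchmer–Wigderson: at an AND gate that is false on T, Bob names a false input; at an OR gate
-- that is true on S, Alice names a true input.  v₀ is only output at constant wires, which are
-- never reached.
module KarchmerWigderson {n : ℕ} (v₀ : Fin n) where

  KW : Set
  KW = Protocol (Subset n) (Subset n) (Fin n)

  Separates : Subset n → Subset n → Fin n → Set
  Separates S T i = lookup S i ≡ true × lookup T i ≡ false

  kwWire : ∀ {k} → Vec KW k → Wire n k → KW
  kwWire ps (var i)   = leaf i
  kwWire ps (const _) = leaf v₀
  kwWire ps (gate j)  = lookup ps j

  kwGate : ∀ {k} → Gates n k → Vec KW k → Gate n k → KW
  kwGate gs ps (AND p q) = ask Bob   (λ T → evalWire T (evalGates T gs) p) (kwWire ps p) (kwWire ps q)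
  kwGate gs ps (OR p q)  = ask Alice (λ S → evalWire S (evalGates S gs) p) (kwWire ps q) (kwWire ps p)

  kwGates : ∀ {k} → Gates n k → Vec KW k
  kwGates []       = []
  kwGates (gs ▷ g) = let ps = kwGates gs in ps ∷ʳ kwGate gs ps g

  kw : Circuit n → KW
  kw C = kwWire (kwGates (gates C)) (out C)

  module _ (S T : Subset n) where

    SoundAt : ∀ {k} → Gates n k → Fin k → Set
    SoundAt gs j = lookup (evalGates S gs) j ≡ true → lookup (evalGates T gs) j ≡ false →
                   Within (lookup (kwGates gs) j) S T (lookup (depthGates gs) j) (Separates S T)

    kwWire-sound : ∀ {k} (gs : Gates n k) → (∀ j → SoundAt gs j) → ∀ w →
                   evalWire S (evalGates S gs) w ≡ true → evalWire T (evalGates T gs) w ≡ false →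
                   Within (kwWire (kwGates gs) w) S T (depthWire (depthGates gs) w) (Separates S T)
    kwWire-sound gs sound (var i)       S∋i T∌i = leaf-within (S∋i , T∌i)
    kwWire-sound gs sound (const false) ()
    kwWire-sound gs sound (const true)  _ ()
    kwWire-sound gs sound (gate j)      = sound j

    kwGate-sound : ∀ {k} (gs : Gates n k) → (∀ j → SoundAt gs j) → ∀ g →
                   evalGate S (evalGates S gs) g ≡ true → evalGate T (evalGates T gs) g ≡ false →
                   Within (kwGate gs (kwGates gs) g) S T (depthGate (depthGates gs) g) (Separates S T)
    kwGate-sound gs sound (AND p q) onS onT with evalWire T (evalGates T gs) p in p-onT
    ... | false = ask-within Bob _ false p-onT
          (within-mono (m≤m⊔n _ _) id (kwWire-sound gs sound p (∧-conicalˡ _ _ onS) p-onT))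
    ... | true  = ask-within Bob _ true p-onT
          (within-mono (m≤n⊔m _ _) id (kwWire-sound gs sound q (∧-conicalʳ _ _ onS) onT))
    kwGate-sound gs sound (OR p q) onS onT with evalWire S (evalGates S gs) p in p-onS
    ... | true  = ask-within Alice _ true p-onS
          (within-mono (m≤m⊔n _ _) id (kwWire-sound gs sound p p-onS (∨-conicalˡ _ _ onT)))
    ... | false = ask-within Alice _ false p-onS
          (within-mono (m≤n⊔m _ _) id (kwWire-sound gs sound q onS (∨-conicalʳ _ _ onT)))

    kwGates-sound : ∀ {k} (gs : Gates n k) j → SoundAt gs j
    kwGates-sound (gs ▷ g) j with view j
    ... | ‵fromℕ
      rewrite lookup-∷ʳ-fromℕ (evalGates S gs) (evalGate S (evalGates S gs) g)
            | lookup-∷ʳ-fromℕ (evalGates T gs) (evalGate T (evalGates T gs) g)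
            | lookup-∷ʳ-fromℕ (depthGates gs) (depthGate (depthGates gs) g)
            | lookup-∷ʳ-fromℕ (kwGates gs) (kwGate gs (kwGates gs) g)
      = kwGate-sound gs (kwGates-sound gs) g
    ... | ‵inject₁ i
      rewrite lookup-∷ʳ-inject₁ (evalGates S gs) (evalGate S (evalGates S gs) g) i
            | lookup-∷ʳ-inject₁ (evalGates T gs) (evalGate T (evalGates T gs) g) i
            | lookup-∷ʳ-inject₁ (depthGates gs) (depthGate (depthGates gs) g) i
            | lookup-∷ʳ-inject₁ (kwGates gs) (kwGate gs (kwGates gs) g) i
      = kwGates-sound gs i

  kw-sound : ∀ C {S T} → eval C S ≡ true → eval C T ≡ false →
             Within (kw C) S T (depth C) (Separates S T)
  kw-sound C {S} {T} = kwWire-sound S T (gates C) (kwGates-sound S T (gates C)) (out C)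

infixr 6 _∧ᶠ_
infixr 5 _∨ᶠ_

data Formula (n : ℕ) : Set where
  var        : Fin n → Formula n
  const      : Bool → Formula n
  _∧ᶠ_ _∨ᶠ_  : Formula n → Formula n → Formula n

module _ {n : ℕ} where

  evalᶠ : Subset n → Formula n → Bool
  evalᶠ S (var i)  = lookup S i
  evalᶠ S (const b) = b
  evalᶠ S (f ∧ᶠ g) = evalᶠ S f ∧ evalᶠ S g
  evalᶠ S (f ∨ᶠ g) = evalᶠ S f ∨ evalᶠ S g

  infix 4 _≼_

  data _≼_ : ∀ {k k′} → Gates n k → Gates n k′ → Set where
    ≼-refl : ∀ {k} {gs : Gates n k} → gs ≼ gs
    ≼-step : ∀ {k k′} {gs : Gates n k} {gs′ : Gates n k′} → gs ≼ gs′ → (g : Gate n k′) → gs ≼ gs′ ▷ g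

  ≼-trans : ∀ {k₁ k₂ k₃} {gs₁ : Gates n k₁} {gs₂ : Gates n k₂} {gs₃ : Gates n k₃} →
            gs₁ ≼ gs₂ → gs₂ ≼ gs₃ → gs₁ ≼ gs₃
  ≼-trans e ≼-refl       = e
  ≼-trans e (≼-step e′ g) = ≼-step (≼-trans e e′) g

  liftGate : ∀ {k k′} {gs : Gates n k} {gs′ : Gates n k′} → gs ≼ gs′ → Fin k → Fin k′
  liftGate ≼-refl       j = j
  liftGate (≼-step e _) j = inject₁ (liftGate e j)

  liftWire : ∀ {k k′} {gs : Gates n k} {gs′ : Gates n k′} → gs ≼ gs′ → Wire n k → Wire n k′
  liftWire e (var i)   = var i
  liftWire e (const b) = const b
  liftWire e (gate j)  = gate (liftGate e j)

  evalGates-lift : ∀ {k k′} {gs : Gates n k} {gs′ : Gates n k′} (e : gs ≼ gs′) S j →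
                   lookup (evalGates S gs′) (liftGate e j) ≡ lookup (evalGates S gs) j
  evalGates-lift ≼-refl S j = refl
  evalGates-lift (≼-step {gs′ = gs′} e g) S j =
    trans (lookup-∷ʳ-inject₁ (evalGates S gs′) _ (liftGate e j)) (evalGates-lift e S j)

  evalWire-lift : ∀ {k k′} {gs : Gates n k} {gs′ : Gates n k′} (e : gs ≼ gs′) S w →
                  evalWire S (evalGates S gs′) (liftWire e w) ≡ evalWire S (evalGates S gs) w
  evalWire-lift e S (var i)   = refl
  evalWire-lift e S (const b) = refl
  evalWire-lift e S (gate j)  = evalGates-lift e S j

  record Compiled {k} (gs : Gates n k) (φ : Subset n → Bool) : Set where
    constructor compiled
    field
      {size′}  : ℕ
      gates′   : Gates n size′
      extends  : gs ≼ gates′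
      wire     : Wire n size′
      computes : ∀ S → evalWire S (evalGates S gates′) wire ≡ φ S
  open Compiled

  compileBinary : ∀ {k} {gs : Gates n k} {φ ψ} (op : ∀ {k} → Wire n k → Wire n k → Gate n k) _⊕_ →
                  (∀ {k} S (vs : Vec Bool k) p q → evalGate S vs (op p q) ≡ evalWire S vs p ⊕ evalWire S vs q) →
                  (c : Compiled gs φ) → Compiled (gates′ c) ψ → Compiled gs (λ S → φ S ⊕ ψ S)
  compileBinary op _⊕_ op-sem (compiled gs₁ e₁ w₁ ok₁) (compiled gs₂ e₂ w₂ ok₂) =
    compiled (gs₂ ▷ op (liftWire e₂ w₁) w₂) (≼-step (≼-trans e₁ e₂) _) (gate (fromℕ _)) λ S →
      trans (lookup-∷ʳ-fromℕ (evalGates S gs₂) _)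
      (trans (op-sem S (evalGates S gs₂) _ _)
             (cong₂ _⊕_ (trans (evalWire-lift e₂ S w₁) (ok₁ S)) (ok₂ S)))

  compile : ∀ {k} (gs : Gates n k) (f : Formula n) → Compiled gs (λ S → evalᶠ S f)
  compile gs (var i)   = compiled gs ≼-refl (var i) λ _ → refl
  compile gs (const b) = compiled gs ≼-refl (const b) λ _ → refl
  compile gs (f ∧ᶠ g)  = let c = compile gs f in
    compileBinary AND _∧_ (λ _ _ _ _ → refl) c (compile (gates′ c) g)
  compile gs (f ∨ᶠ g)  = let c = compile gs f in
    compileBinary OR _∨_ (λ _ _ _ _ → refl) c (compile (gates′ c) g)

  formulaCircuit : Formula n → Circuit n
  formulaCircuit f = let c = compile [] f in circuit (size′ c) (gates′ c) (wire c)

  formulaCircuit-eval : ∀ f S → eval (formulaCircuit f) S ≡ evalᶠ S f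
  formulaCircuit-eval f = computes (compile [] f)

  ⋀ : ∀ {m} → (Fin m → Formula n) → Formula n
  ⋀ {zero}  h = const true
  ⋀ {suc m} h = h zero ∧ᶠ ⋀ (h ∘ suc)

  ⋀-true⁻ : ∀ {m} (h : Fin m → Formula n) {S} → evalᶠ S (⋀ h) ≡ true → ∀ i → evalᶠ S (h i) ≡ true
  ⋀-true⁻ h holds zero    = ∧-conicalˡ _ _ holds
  ⋀-true⁻ h holds (suc i) = ⋀-true⁻ (h ∘ suc) (∧-conicalʳ _ _ holds) i

  ⋀-true⁺ : ∀ {m} (h : Fin m → Formula n) {S} → (∀ i → evalᶠ S (h i) ≡ true) → evalᶠ S (⋀ h) ≡ true
  ⋀-true⁺ {zero}  h all = refl
  ⋀-true⁺ {suc m} h all = cong₂ _∧_ (all zero) (⋀-true⁺ (h ∘ suc) (all ∘ suc))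

  ⋁ˢ : ∀ {m} → (Subset m → Formula n) → Formula n
  ⋁ˢ {zero}  h = h []
  ⋁ˢ {suc m} h = ⋁ˢ (h ∘ (true ∷_)) ∨ᶠ ⋁ˢ (h ∘ (false ∷_))

  ⋁ˢ-true⁻ : ∀ {m} (h : Subset m → Formula n) {S} → evalᶠ S (⋁ˢ h) ≡ true → ∃ λ T → evalᶠ S (h T) ≡ true
  ⋁ˢ-true⁻ {zero} h holds = [] , holds
  ⋁ˢ-true⁻ {suc m} h {S} holds with evalᶠ S (⋁ˢ (h ∘ (true ∷_))) in left
  ... | true  = let T , hT = ⋁ˢ-true⁻ (h ∘ (true ∷_)) left in true ∷ T , hT
  ... | false = let T , hT = ⋁ˢ-true⁻ (h ∘ (false ∷_)) holds in false ∷ T , hT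

  ⋁ˢ-true⁺ : ∀ {m} (h : Subset m → Formula n) {S} T → evalᶠ S (h T) ≡ true → evalᶠ S (⋁ˢ h) ≡ true
  ⋁ˢ-true⁺ h []          holds = holds
  ⋁ˢ-true⁺ h {S} (true ∷ T)  holds =
    cong (_∨ evalᶠ S (⋁ˢ (h ∘ (false ∷_)))) (⋁ˢ-true⁺ (h ∘ (true ∷_)) T holds)
  ⋁ˢ-true⁺ h {S} (false ∷ T) holds =
    trans (cong (evalᶠ S (⋁ˢ (h ∘ (true ∷_))) ∨_) (⋁ˢ-true⁺ (h ∘ (false ∷_)) T holds)) (∨-zeroʳ _)

  guardᶠ : ∀ {P : Set} → Dec P → Formula n → Formula n
  guardᶠ P? f = if does P? then f else const false

  guardᶠ-true⁻ : ∀ {P : Set} (P? : Dec P) f {S} → evalᶠ S (guardᶠ P? f) ≡ true → P × evalᶠ S f ≡ true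
  guardᶠ-true⁻ (yes p) f holds = p , holds

  guardᶠ-true⁺ : ∀ {P : Set} (P? : Dec P) f {S} → P → evalᶠ S f ≡ true → evalᶠ S (guardᶠ P? f) ≡ true
  guardᶠ-true⁺ (yes _) f _ holds = holds
  guardᶠ-true⁺ (no ¬p) f p _     = ⊥-elim (¬p p)

  containsAllᶠ : Subset n → Formula n
  containsAllᶠ T = ⋀ λ v → if lookup T v then var v else const true

  containsAllᶠ-true⁻ : ∀ {S} T → evalᶠ S (containsAllᶠ T) ≡ true → T ⊆ S
  containsAllᶠ-true⁻ {S} T holds {v} v∈T =
    lookup⇒[]= v S (subst (λ b → evalᶠ S (if b then var v else const true) ≡ true)
                          ([]=⇒lookup v∈T) (⋀-true⁻ _ holds v))

  containsAllᶠ-true⁺ : ∀ {S} T → T ⊆ S → evalᶠ S (containsAllᶠ T) ≡ true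
  containsAllᶠ-true⁺ {S} T T⊆S = ⋀-true⁺ _ member
    where
      member : ∀ v → evalᶠ S (if lookup T v then var v else const true) ≡ true
      member v with lookup T v in v∈T
      ... | true  = []=⇒lookup (T⊆S (lookup⇒[]= v T v∈T))
      ... | false = refl

module _ {n : ℕ} (G : Graph n) where

  NonedgeIn : Subset n → Fin n × Fin n → Set
  NonedgeIn T (u , v) = u ∈ T × v ∈ T × Nonedge G u v

  nonedgeIn? : ∀ T → Dec (∃ (NonedgeIn T))
  nonedgeIn? T = map′ (λ (u , v , h) → (u , v) , h) (λ ((u , v) , h) → u , v , h)
    (any? λ u → any? λ v → u ∈? T ×-dec v ∈? T ×-dec ¬? (u ≟ v) ×-dec ¬? (dec G u v))

  clique-if-no-nonedge : ∀ T → ¬ ∃ (NonedgeIn T) → IsClique G T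
  clique-if-no-nonedge T ∄ u v u∈T v∈T u≢v =
    decidable-stable (dec G u v) λ ¬uv → ∄ ((u , v) , u∈T , v∈T , u≢v , ¬uv)

  isClique? : ∀ T → Dec (IsClique G T)
  isClique? T with nonedgeIn? T
  ... | yes ((u , v) , u∈T , v∈T , u≢v , ¬uv) = no λ clique → ¬uv (clique u v u∈T v∈T u≢v)
  ... | no ∄                                = yes (clique-if-no-nonedge T ∄)

  clique-∪ : ∀ {S T} → IsClique G S → IsClique G T → (∀ {u v} → u ∈ S → v ∈ T → E G u v) →
             IsClique G (S ∪ T)
  clique-∪ {S} {T} clique-S clique-T adjacent u v u∈ v∈ u≢v with x∈p∪q⁻ S T u∈ | x∈p∪q⁻ S T v∈
  ... | inj₁ u∈S | inj₁ v∈S = clique-S u v u∈S v∈S u≢v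
  ... | inj₁ u∈S | inj₂ v∈T = adjacent u∈S v∈T
  ... | inj₂ u∈T | inj₁ v∈S = sym G (adjacent v∈S u∈T)
  ... | inj₂ u∈T | inj₂ v∈T = clique-T u v u∈T v∈T u≢v

  Nonneighbour : Fin n → Subset n → Fin n → Set
  Nonneighbour i b j = j ∈ b × ¬ E G i j

  nonneighbour? : ∀ i b → Dec (∃ (Nonneighbour i b))
  nonneighbour? i b = any? λ j → j ∈? b ×-dec ¬? (dec G i j)

  commonNeighbours : Subset n → Subset n
  commonNeighbours b = tabulate λ i → does (¬? (nonneighbour? i b))

  commonNeighbours-adjacent : ∀ {b i j} → i ∈ commonNeighbours b → j ∈ b → E G i j
  commonNeighbours-adjacent {b} {i} {j} i∈N j∈b = decidable-stable (dec G i j) λ ¬ij →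
    does-true (¬? (nonneighbour? i b)) (trans (≡.sym (lookup∘tabulate _ i)) ([]=⇒lookup i∈N))
              (j , j∈b , ¬ij)

  nonneighbour-of-outsider : ∀ {b i} → lookup (commonNeighbours b) i ≡ false → ∃ (Nonneighbour i b)
  nonneighbour-of-outsider {b} {i} i∉N = decidable-stable (nonneighbour? i b)
    (does-false (¬? (nonneighbour? i b)) (trans (≡.sym (lookup∘tabulate _ i)) i∉N))

  -- A k-clique among the common neighbours of a clique b extends to a (k + ∣b∣)-clique.
  no-kClique-in-commonNeighbours : ∀ {w k b} → (∀ T → IsClique G T → ∣ T ∣ ≤ w) →
                                   IsClique G b → w < k + ∣ b ∣ → ¬ HasKClique G k (commonNeighbours b)
  no-kClique-in-commonNeighbours {w} {k} {b} ω-max clique-b w<k+∣b∣ (T , T⊆N , clique-T , ∣T∣≡k) =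
    ℕ.<⇒≱ w<k+∣b∣ (subst (_≤ w) ∣T∪b∣≡k+∣b∣ (ω-max (T ∪ b) (clique-∪ clique-T clique-b adjacent)))
    where
      adjacent : ∀ {u v} → u ∈ T → v ∈ b → E G u v
      adjacent u∈T = commonNeighbours-adjacent (T⊆N u∈T)

      ∣T∪b∣≡k+∣b∣ : ∣ T ∪ b ∣ ≡ k + ∣ b ∣
      ∣T∪b∣≡k+∣b∣ = trans (∣p∪q∣≡∣p∣+∣q∣ T b (λ i∈T i∈b → irrefl G (adjacent i∈T i∈b)))
                          (cong (_+ ∣ b ∣) ∣T∣≡k)

  cliqueDNF : ℕ → Formula n
  cliqueDNF k = ⋁ˢ λ T → guardᶠ (isClique? T ×-dec ∣ T ∣ ℕ.≟ k) (containsAllᶠ T)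

  cliqueCircuit : ℕ → Circuit n
  cliqueCircuit k = formulaCircuit (cliqueDNF k)

  cliqueCircuit-computes : ∀ k → Computes G (cliqueCircuit k) k
  cliqueCircuit-computes k S = mk⇔
    (λ holds →
      let T , guarded = ⋁ˢ-true⁻ _ (trans (≡.sym (formulaCircuit-eval (cliqueDNF k) S)) holds)
          (clique , size) , contained = guardᶠ-true⁻ (isClique? T ×-dec ∣ T ∣ ℕ.≟ k) _ guarded
      in T , (λ {v} → containsAllᶠ-true⁻ T contained {v}) , clique , size)
    (λ (T , T⊆S , clique , size) →
      trans (formulaCircuit-eval (cliqueDNF k) S)
            (⋁ˢ-true⁺ _ T (guardᶠ-true⁺ (isClique? T ×-dec ∣ T ∣ ℕ.≟ k) _ (clique , size)
                                        (containsAllᶠ-true⁺ T T⊆S))))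

  ¬¬-minDepth : ∀ k → ¬ ¬ ∃ (IsMinDepth G k)
  ¬¬-minDepth k =
    ¬¬-map (λ (δ , achieved , least) → δ , achieved , λ C computes → least (depth C) (C , computes , refl))
           (¬¬-least (λ δ → ∃ λ C → Computes G C k × depth C ≡ δ)
                     (cliqueCircuit k , cliqueCircuit-computes k , refl))

  shallowCircuit : ∀ {d} → IsD G d → ∀ k → 1 ≤ k → k ≤ n → ¬ ¬ ∃ λ C → Computes G C k × depth C ≤ d
  shallowCircuit isD k 1≤k k≤n =
    ¬¬-map (λ { (δ , minDepth@((C , computes , refl) , _)) → C , computes , proj₁ isD k δ 1≤k k≤n minDepth })
           (¬¬-minDepth k)

module CliqueGame {m : ℕ} (G : Graph (suc m)) (L : ℕ) (circuit : Fin (suc m) → Circuit (suc m)) where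
  open KarchmerWigderson {suc m} zero

  Vertex : Set
  Vertex = Fin (suc m)

  Play : Set → Set
  Play = Protocol (Subset (suc m)) (Subset (suc m))

  -- pred ∣ a ∣, so that the sizes 1, …, n fit into Fin n.
  sizeIndex : Subset (suc m) → Vertex
  sizeIndex a = fromℕ< (s≤s (ℕ.pred-mono-≤ (∣p∣≤n a)))

  pickNonedge : Subset (suc m) → Vertex × Vertex
  pickNonedge T = witness (zero , zero) (nonedgeIn? G T)

  pickNonedge-correct : ∀ {T} → ∃ (NonedgeIn G T) → NonedgeIn G T (pickNonedge T)
  pickNonedge-correct {T} = witness-holds (zero , zero) (nonedgeIn? G T)

  pickNonneighbour : Vertex → Subset (suc m) → Vertex
  pickNonneighbour i b = witness zero (nonneighbour? G i b)

  pickNonneighbour-correct : ∀ {i b} → ∃ (Nonneighbour G i b) → Nonneighbour G i b (pickNonneighbour i b)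
  pickNonneighbour-correct {i} {b} = witness-holds zero (nonneighbour? G i b)

  separate : Play (Vertex × Vertex)
  separate = do
    k ← sendFin Alice L sizeIndex
    i ← relabel id (commonNeighbours G) (kw (circuit k))
    map (i ,_) (sendFin Bob L (pickNonneighbour i))

  protocol : Play (Vertex × Vertex)
  protocol =
    ask Alice (does ∘ nonedgeIn? G)
      (ask Bob (does ∘ nonedgeIn? G) separate (sendPair Bob L pickNonedge))
      (sendPair Alice L pickNonedge)

  Answer : Subset (suc m) → Subset (suc m) → Vertex × Vertex → Set
  Answer a b (u , v) = u ∈ a ∪ b × v ∈ a ∪ b × Nonedge G u v

  nonedgeIn-left : ∀ {a b e} → NonedgeIn G a e → Answer a b e
  nonedgeIn-left (u∈a , v∈a , uv) = x∈p∪q⁺ (inj₁ u∈a) , x∈p∪q⁺ (inj₁ v∈a) , uv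

  nonedgeIn-right : ∀ {a b e} → NonedgeIn G b e → Answer a b e
  nonedgeIn-right (u∈b , v∈b , uv) = x∈p∪q⁺ (inj₂ u∈b) , x∈p∪q⁺ (inj₂ v∈b) , uv

  module _ {w d : ℕ} (ω-max : ∀ T → IsClique G T → ∣ T ∣ ≤ w) (n≤2^L : suc m ≤ 2 ^ L)
           (shallow : ∀ k → Computes G (circuit k) (suc (toℕ k)) × depth (circuit k) ≤ d) where

    separate-within : ∀ {a b} → ValidInput G w a b → IsClique G a → IsClique G b →
                      Within separate a b (L + (d + L)) (Answer a b)
    separate-within {a} {b} (disjoint , w<∣a∣+∣b∣) clique-a clique-b =
      >>=-within (sendFin-within Alice L sizeIndex n≤2^L) λ { refl →
      >>=-within (relabel-within id (commonNeighbours G) a b separation) λ { (i∈a , i∉N) →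
      map-within (sendFin-within Bob L (pickNonneighbour _) n≤2^L) λ { refl →
      answer (lookup⇒[]= _ a i∈a) (pickNonneighbour-correct (nonneighbour-of-outsider G i∉N)) } } }
      where
        k = sizeIndex a
        computes = proj₁ (shallow k)

        k-size : ∣ a ∣ ≡ suc (toℕ k)
        k-size = ≡.sym (trans (cong suc (toℕ-fromℕ< _))
                              (ℕ.suc-pred ∣ a ∣ {{>-nonZero (n≤o<m+n⇒0<m (ω-max b clique-b) w<∣a∣+∣b∣)}}))

        a-accepted : eval (circuit k) a ≡ true
        a-accepted = Equivalence.from (computes a) (a , id , clique-a , k-size)

        b-rejected : eval (circuit k) (commonNeighbours G b) ≡ false
        b-rejected = ¬-not λ accepted →
          no-kClique-in-commonNeighbours G ω-max clique-b (subst (λ s → w < s + ∣ b ∣) k-size w<∣a∣+∣b∣)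
            (Equivalence.to (computes (commonNeighbours G b)) accepted)

        separation : Within (kw (circuit k)) a (commonNeighbours G b) d (Separates a (commonNeighbours G b))
        separation = within-mono (proj₂ (shallow k)) id (kw-sound (circuit k) a-accepted b-rejected)

        answer : ∀ {i j} → i ∈ a → Nonneighbour G i b j → Answer a b (i , j)
        answer i∈a (j∈b , ¬ij) =
          x∈p∪q⁺ (inj₁ i∈a) , x∈p∪q⁺ (inj₂ j∈b) , (λ { refl → disjoint _ i∈a j∈b }) , ¬ij

    L+L≤L+[d+L] : L + L ≤ L + (d + L)
    L+L≤L+[d+L] = +-monoʳ-≤ L (ℕ.m≤n+m L d)

    protocol-within : ∀ {a b} → ValidInput G w a b → Within protocol a b (2 + (L + (d + L))) (Answer a b)
    protocol-within {a} {b} valid with nonedgeIn? G a | nonedgeIn? G b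
    ... | yes nonedge-a | _ =
      ask-within Alice _ true (dec-true (nonedgeIn? G a) nonedge-a)
        (within-mono (≤-trans L+L≤L+[d+L] (ℕ.n≤1+n _))
                     (λ { refl → nonedgeIn-left (pickNonedge-correct nonedge-a) })
                     (sendPair-within Alice L pickNonedge n≤2^L))
    ... | no clique-a | yes nonedge-b =
      ask-within Alice _ false (dec-false (nonedgeIn? G a) clique-a)
        (ask-within Bob _ true (dec-true (nonedgeIn? G b) nonedge-b)
          (within-mono L+L≤L+[d+L]
                       (λ { refl → nonedgeIn-right (pickNonedge-correct nonedge-b) })
                       (sendPair-within Bob L pickNonedge n≤2^L)))
    ... | no clique-a | no clique-b =
      ask-within Alice _ false (dec-false (nonedgeIn? G a) clique-a)
        (ask-within Bob _ false (dec-false (nonedgeIn? G b) clique-b)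
          (separate-within valid (clique-if-no-nonedge G a clique-a) (clique-if-no-nonedge G b clique-b)))

    protocol-solves : SolvesWithin G w protocol (2 + (L + (d + L)))
    protocol-solves a b valid = let within bits≤ answer = protocol-within valid in bits≤ , answer

cc-bound : ∀ {m} (G : Graph (suc m)) {w c d L} → (∀ T → IsClique G T → ∣ T ∣ ≤ w) →
           IsCC G w c → IsD G d → suc m ≤ 2 ^ L → c ≤ 2 + (L + (d + L))
cc-bound G {L = L} ω-max (_ , minimal) isD n≤2^L =
  decidable-stable (_ ≤? _) (¬¬-map (λ shallow → minimal _ (game shallow))
                                    (¬¬-choice λ k → shallowCircuit G isD (suc (toℕ k)) (s≤s z≤n) (toℕ<n k)))
  where
    game : (∀ k → ∃ λ C → Computes G C (suc (toℕ k)) × depth C ≤ _) → CCAtMost G _ _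
    game shallow = let open CliqueGame G L (proj₁ ∘ shallow) in
      protocol , protocol-solves ω-max n≤2^L (proj₂ ∘ shallow)

log₂-bracket : ∀ m → ∃ λ L → suc m ≤ 2 ^ L × 2 ^ L ≤ 2 * suc m
log₂-bracket zero = 0 , ≤-refl , s≤s z≤n
log₂-bracket (suc m) with log₂-bracket m
... | L , 1+m≤2^L , 2^L≤2+2m with suc (suc m) ≤? 2 ^ L
...   | yes 2+m≤2^L = L , 2+m≤2^L , ≤-trans 2^L≤2+2m (ℕ.*-monoʳ-≤ 2 (ℕ.n≤1+n (suc m)))
...   | no  2+m≰2^L =
  suc L , subst (suc (suc m) ≤_) (cong (2 *_) (≡.sym 2^L≡1+m)) 2+m≤2+2m ,
          ℕ.*-monoʳ-≤ 2 (≤-trans (≤-reflexive 2^L≡1+m) (ℕ.n≤1+n (suc m)))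
  where
    2^L≡1+m : 2 ^ L ≡ suc m
    2^L≡1+m = ℕ.≤-antisym (ℕ.≤-pred (≰⇒> 2+m≰2^L)) 1+m≤2^L

    2+m≤2+2m : suc (suc m) ≤ 2 * suc m
    2+m≤2+2m = subst (suc (suc m) ≤_) (≡.sym (ℕ.*-suc 2 m)) (+-monoʳ-≤ 2 (ℕ.m≤n*m m 2))

2^[2+L+d+L]≤2^[d+4]*n² : ∀ {L d n} → 2 ^ L ≤ 2 * n → 2 ^ (2 + (L + (d + L))) ≤ 2 ^ (d + 4) * (n * n)
2^[2+L+d+L]≤2^[d+4]*n² {L} {d} {n} 2^L≤2n = begin
  2 ^ (2 + (L + (d + L)))        ≡⟨ ℕ.^-distribˡ-+-* 2 2 (L + (d + L)) ⟩
  4 * 2 ^ (L + (d + L))          ≡⟨ cong (4 *_) (ℕ.^-distribˡ-+-* 2 L (d + L)) ⟩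
  4 * (2 ^ L * 2 ^ (d + L))      ≡⟨ cong (λ x → 4 * (2 ^ L * x)) (ℕ.^-distribˡ-+-* 2 d L) ⟩
  4 * (2 ^ L * (2 ^ d * 2 ^ L))  ≤⟨ ℕ.*-monoʳ-≤ 4 (ℕ.*-mono-≤ 2^L≤2n (ℕ.*-monoʳ-≤ (2 ^ d) 2^L≤2n)) ⟩
  4 * (2 * n * (2 ^ d * (2 * n))) ≡⟨ rearrange (2 ^ d) n ⟩
  2 ^ d * 16 * (n * n)           ≡⟨ cong (_* (n * n)) (≡.sym (ℕ.^-distribˡ-+-* 2 d 4)) ⟩
  2 ^ (d + 4) * (n * n)          ∎
  where
    open ℕ.≤-Reasoning
    rearrange : ∀ x n → 4 * (2 * n * (x * (2 * n))) ≡ x * 16 * (n * n)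
    rearrange = solve-∀

theorem2 : ∃ λ (c₀ : ℕ) →
    ∀ (n : ℕ) → 2 ≤ n → (G : Graph n) → NoCompleteStar G →
    ∀ (w c d : ℕ) → IsCliqueNumber G w → IsCC G w c → IsD G d →
    -- c ≤ d + 2 log₂ n + c₀, i.e. 2^c ≤ 2^(d + c₀) * n²
    2 ^ c ≤ 2 ^ (d + c₀) * (n * n)
theorem2 = 4 , λ where
  (suc m) _ G _ w c d (_ , ω-max) isCC isD →
    let L , n≤2^L , 2^L≤2n = log₂-bracket m in
    ≤-trans (ℕ.^-monoʳ-≤ 2 (cc-bound G {L = L} ω-max isCC isD n≤2^L))
            (2^[2+L+d+L]≤2^[d+4]*n² {L} {d} {suc m} 2^L≤2n)
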